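{- Let $G$ be a rich square. Then $\chi(G)\leq 4$.
   Context: Let $S=\{u_1,u_2,u_3,u_4\}$ induce a $C_4$ in a graph $K$, with $u_1,u_2,u_3,u_4$ in this order along the cycle. A link of $S$ is an induced path $P$ of $K$ with ends $p,p'$ such that no interior vertex of $P$ has a neighbor in $S$, and either $p=p'$ and $N_S(p)=S$, or $N_S(p)=\{u_1,u_2\}$ and $N_S(p')=\{u_3,u_4\}$, or $N_S(p)=\{u_1,u_4\}$ and $N_S(p')=\{u_2,u_3\}$ (here $N_S(v)$ is the set of neighbors of $v$ in $S$). A rich square is a graph $K$ containing such an induced square $S$ such that $K\setminus S$ has at least two connected components and every component of $K\setminus S$ is a link of $S$. -}

module Defs where

open import Data.Nat using (ℕ; zero; suc; _<_)
open import Data.Fin using (Fin; toℕ; fromℕ) renaming (zero to fzero)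
open import Data.Bool using (Bool; true; false)
open import Data.Product using (Σ; ∃; _×_; _,_)
open import Data.Sum using (_⊎_)
open import Relation.Nullary using (¬_)
open import Relation.Binary.PropositionalEquality using (_≡_; _≢_)
open import Relation.Binary.Construct.Closure.ReflexiveTransitive using (Star)
open import Function.Bundles using (_⇔_)

record Graph : Set where
  field
    n      : ℕ
    adj    : Fin n → Fin n → Bool
    adj-sym    : ∀ u v → adj u v ≡ adj v u
    adj-irrefl : ∀ v → adj v v ≡ false

module _ (G : Graph) where
  open Graph G

  Adj : Fin n → Fin n → Set
  Adj u v = adj u v ≡ true

  ProperColouring : ℕ → Set
  ProperColouring k = Σ (Fin n → Fin k) λ c → ∀ u v → Adj u v → c u ≢ c v

  χ≤ : ℕ → Set
  χ≤ k = ProperColouring k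

  module Square (u₁ u₂ u₃ u₄ : Fin n) where

    NotInS : Fin n → Set
    NotInS v = v ≢ u₁ × v ≢ u₂ × v ≢ u₃ × v ≢ u₄

    InducedC4 : Set
    InducedC4 =
      (u₁ ≢ u₂ × u₁ ≢ u₃ × u₁ ≢ u₄ × u₂ ≢ u₃ × u₂ ≢ u₄ × u₃ ≢ u₄) ×
      (Adj u₁ u₂ × Adj u₂ u₃ × Adj u₃ u₄ × Adj u₄ u₁) ×
      (¬ Adj u₁ u₃ × ¬ Adj u₂ u₄)

    AdjOut : Fin n → Fin n → Set
    AdjOut x y = Adj x y × NotInS x × NotInS y

    Connected : Fin n → Fin n → Set
    Connected = Star AdjOut

    -- N_S(v) = {a , b} where c, d are the other two vertices of S
    NS-is : Fin n → Fin n → Fin n → Fin n → Fin n → Set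
    NS-is v a b c d = Adj v a × Adj v b × ¬ Adj v c × ¬ Adj v d

    NS-all : Fin n → Set
    NS-all v = Adj v u₁ × Adj v u₂ × Adj v u₃ × Adj v u₄

    ComponentIsLink : Fin n → Set
    ComponentIsLink x =
      Σ ℕ λ k → Σ (Fin (suc k) → Fin n) λ f →
        (∀ y → (Connected x y ⇔ (∃ λ i → f i ≡ y))) ×
        (∀ i j → f i ≡ f j → i ≡ j) ×
        (∀ i j → Adj (f i) (f j) ⇔ (toℕ i ≡ suc (toℕ j) ⊎ toℕ j ≡ suc (toℕ i))) ×
        (∀ i → 0 < toℕ i → toℕ i < k →
           ¬ Adj (f i) u₁ × ¬ Adj (f i) u₂ × ¬ Adj (f i) u₃ × ¬ Adj (f i) u₄) ×
        ( (k ≡ 0 × NS-all (f (fromℕ k)))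
        ⊎ (NS-is (f (fzero)) u₁ u₂ u₃ u₄ × NS-is (f (fromℕ k)) u₃ u₄ u₁ u₂)
        ⊎ (NS-is (f (fzero)) u₁ u₄ u₂ u₃ × NS-is (f (fromℕ k)) u₂ u₃ u₁ u₄))

    RichSquareOn : Set
    RichSquareOn =
      InducedC4 ×
      (Σ (Fin n) λ x → Σ (Fin n) λ y → NotInS x × NotInS y × ¬ Connected x y) ×
      (∀ x → NotInS x → ComponentIsLink x)

  RichSquare : Set
  RichSquare = Σ (Fin n) λ u₁ → Σ (Fin n) λ u₂ → Σ (Fin n) λ u₃ → Σ (Fin n) λ u₄ →
    Square.RichSquareOn u₁ u₂ u₃ u₄

-- The diagonals {u₁, u₃} and {u₂, u₄} of the square are independent, so S takes two
-- colours. Every component of K ∖ S is an induced path and takes two further colours,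
-- alternating along the path; to make this a single function on K ∖ S, each vertex reads
-- its colour off the path of the least vertex of its component.
module Submission where

open import Level using (0ℓ)
open import Data.Nat using (ℕ; zero; suc; _+_)
open import Data.Fin using (Fin; toℕ; fromℕ<; inject; opposite; splitAt; _↑ˡ_; _↑ʳ_; _<_)
  renaming (zero to fzero; suc to fsuc)
open import Data.Fin.Properties
  using (_≟_; any?; <-cmp; toℕ-injective; toℕ-inject; toℕ-fromℕ<; ↑ˡ-injective; ↑ʳ-injective;
         splitAt-↑ˡ; splitAt-↑ʳ; ¬∀⟶∃¬-smallest)
open import Data.Product using (Σ; ∃; _×_; _,_; proj₁; proj₂)
open import Data.Sum using (_⊎_; inj₁; inj₂)
open import Function using (_∘_)
open import Function.Bundles using (_⇔_; mk⇔; Equivalence)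
open import Relation.Nullary using (¬_; yes; no; contradiction)
open import Relation.Nullary.Decidable using (map′; decidable-stable; ¬?; _×-dec_; _⊎-dec_)
open import Relation.Unary using (Pred; Decidable; Universal; _∪_; _≐_)
open import Relation.Binary.Definitions using (tri<; tri≈; tri>)
open import Relation.Binary.PropositionalEquality using (_≡_; _≢_; refl; sym; trans; cong; subst)
open import Relation.Binary.Construct.Closure.ReflexiveTransitive using (Star; ε; _◅_; _◅◅_; reverse)

open import Defs

↑ˡ≢↑ʳ : ∀ {k l} {i : Fin k} {j : Fin l} → i ↑ˡ l ≢ k ↑ʳ j
↑ˡ≢↑ʳ {k} {l} {i} {j} eq
  with trans (sym (splitAt-↑ˡ k i l)) (trans (cong (splitAt k) eq) (splitAt-↑ʳ k l j))
... | ()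

inject-fromℕ< : ∀ {m} {i j : Fin m} (j<i : j < i) → inject {i = i} (fromℕ< j<i) ≡ j
inject-fromℕ< j<i = toℕ-injective (trans (toℕ-inject _) (toℕ-fromℕ< j<i))

module _ {m : ℕ} where

  Least : Pred (Fin m) 0ℓ → Pred (Fin m) 0ℓ
  Least P i = P i × (∀ {j} → j < i → ¬ P j)

  least : ∀ {P} → Decidable P → ∃ P → ∃ (Least P)
  least {P} P? (w , Pw) with ¬∀⟶∃¬-smallest m (¬_ ∘ P) (¬? ∘ P?) (λ ¬P → ¬P w Pw)
  ... | i , ¬¬Pi , below =
    i , decidable-stable (P? i) ¬¬Pi ,
    λ {j} j<i → subst (¬_ ∘ P) (inject-fromℕ< j<i) (below (fromℕ< j<i))

  least-unique : ∀ {P Q} → P ≐ Q → ∀ {i j} → Least P i → Least Q j → i ≡ j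
  least-unique (P⊆Q , Q⊆P) {i} {j} (Pi , i-least) (Qj , j-least) with <-cmp i j
  ... | tri< i<j _ _ = contradiction (P⊆Q Pi) (j-least i<j)
  ... | tri≈ _ i≡j _ = i≡j
  ... | tri> _ _ j<i = contradiction (Q⊆P Qj) (i-least j<i)

alternate : ℕ → Fin 2
alternate zero    = fzero
alternate (suc m) = opposite (alternate m)

alternate-suc : ∀ m → alternate (suc m) ≢ alternate m
alternate-suc m with alternate m
... | fzero      = λ ()
... | fsuc fzero = λ ()

alternate-consecutive : ∀ {m n} → m ≡ suc n ⊎ n ≡ suc m → alternate m ≢ alternate n
alternate-consecutive {n = n} (inj₁ refl) = alternate-suc n
alternate-consecutive {m}     (inj₂ refl) = alternate-suc m ∘ sym

module _ (G : Graph) where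
  open Graph G

  Adj-sym : ∀ {u v} → Adj G u v → Adj G v u
  Adj-sym {u} {v} uv = trans (adj-sym v u) uv

  Adj-irrefl : ∀ v → ¬ Adj G v v
  Adj-irrefl v vv = contradiction (trans (sym vv) (adj-irrefl v)) λ ()

  ProperColouringOn : Pred (Fin n) 0ℓ → ℕ → Set
  ProperColouringOn P k =
    Σ (Fin n → Fin k) λ c → ∀ {u v} → P u → P v → Adj G u v → c u ≢ c v

  universal-colouring : ∀ {P k} → Universal P → ProperColouringOn P k → ProperColouring G k
  universal-colouring all-P (c , proper) = c , λ u v → proper (all-P u) (all-P v)

  Independent : Pred (Fin n) 0ℓ → Set
  Independent P = ∀ {u v} → P u → P v → ¬ Adj G u v

  independent-colouring : ∀ {P} → Independent P → ProperColouringOn P 1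
  independent-colouring indep = (λ _ → fzero) , λ Pu Pv uv _ → indep Pu Pv uv

  pair-independent : ∀ {a b} → ¬ Adj G a b → Independent (λ v → v ≡ a ⊎ v ≡ b)
  pair-independent {a} _  (inj₁ refl) (inj₁ refl) = Adj-irrefl a
  pair-independent ¬ab    (inj₁ refl) (inj₂ refl) = ¬ab
  pair-independent ¬ab    (inj₂ refl) (inj₁ refl) = ¬ab ∘ Adj-sym
  pair-independent {b = b} _ (inj₂ refl) (inj₂ refl) = Adj-irrefl b

  colouring-∪ : ∀ {P Q k l} → Decidable P →
                ProperColouringOn P k → ProperColouringOn Q l → ProperColouringOn (P ∪ Q) (k + l)
  colouring-∪ {P} {Q} {k} {l} P? (c , c-proper) (d , d-proper) = e , e-proper
    where
    e : Fin n → Fin (k + l)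
    e v with P? v
    ... | yes _ = c v ↑ˡ l
    ... | no _  = k ↑ʳ d v

    in-Q : ∀ {v} → (P ∪ Q) v → ¬ P v → Q v
    in-Q (inj₁ Pv) ¬Pv = contradiction Pv ¬Pv
    in-Q (inj₂ Qv) _   = Qv

    e-proper : ∀ {u v} → (P ∪ Q) u → (P ∪ Q) v → Adj G u v → e u ≢ e v
    e-proper {u} {v} PQu PQv uv with P? u | P? v
    ... | yes Pu  | yes Pv  = c-proper Pu Pv uv ∘ ↑ˡ-injective l _ _
    ... | yes _   | no _    = ↑ˡ≢↑ʳ
    ... | no _    | yes _   = ↑ˡ≢↑ʳ ∘ sym
    ... | no ¬Pu  | no ¬Pv  = d-proper (in-Q PQu ¬Pu) (in-Q PQv ¬Pv) uv ∘ ↑ʳ-injective k _ _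

  record ConsecutiveEnumeration (Q : Pred (Fin n) 0ℓ) : Set where
    field
      len    : ℕ
      vertex : Fin (suc len) → Fin n
      spans  : ∀ y → Q y ⇔ ∃ λ i → vertex i ≡ y
      adjacent⇒consecutive : ∀ i j → Adj G (vertex i) (vertex j) →
                             toℕ i ≡ suc (toℕ j) ⊎ toℕ j ≡ suc (toℕ i)

    decidable : Decidable Q
    decidable y =
      map′ (Equivalence.from (spans y)) (Equivalence.to (spans y)) (any? λ i → vertex i ≟ y)

    colouring : ProperColouringOn Q 2
    colouring = c , c-proper
      where
      c : Fin n → Fin 2
      c y with any? (λ i → vertex i ≟ y)
      ... | yes (i , _) = alternate (toℕ i)
      ... | no _        = fzero

      c-proper : ∀ {u v} → Q u → Q v → Adj G u v → c u ≢ c v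
      c-proper {u} {v} Qu Qv uv with any? (λ i → vertex i ≟ u) | any? (λ i → vertex i ≟ v)
      ... | yes (i , refl) | yes (j , refl) = alternate-consecutive (adjacent⇒consecutive i j uv)
      ... | no u∉ | _     = contradiction (Equivalence.to (spans u) Qu) u∉
      ... | _     | no v∉ = contradiction (Equivalence.to (spans v) Qv) v∉

  module _ (P : Pred (Fin n) 0ℓ) where

    AdjIn : Fin n → Fin n → Set
    AdjIn x y = Adj G x y × P x × P y

    ConnectedIn : Fin n → Fin n → Set
    ConnectedIn = Star AdjIn

    connectedIn-sym : ∀ {x y} → ConnectedIn x y → ConnectedIn y x
    connectedIn-sym = reverse λ (xy , Px , Py) → Adj-sym xy , Py , Px

    connectedIn-outside : ∀ {x y} → ¬ P x → ConnectedIn x y → x ≡ y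
    connectedIn-outside _   ε                  = refl
    connectedIn-outside ¬Px ((_ , Px , _) ◅ _) = contradiction Px ¬Px

  colouring-by-components : ∀ {P k} → (∀ x → Decidable (ConnectedIn P x)) →
                            (∀ x → ProperColouringOn (ConnectedIn P x) k) → ProperColouringOn P k
  colouring-by-components {P} {k} conn? component-colouring = c , c-proper
    where
    representative : ∀ v → ∃ (Least (ConnectedIn P v))
    representative v = least (conn? v) (v , ε)

    rep : Fin n → Fin n
    rep v = proj₁ (representative v)

    rep-cong : ∀ {u v} → ConnectedIn P u v → rep u ≡ rep v
    rep-cong {u} {v} uv = least-unique ((connectedIn-sym P uv ◅◅_) , (uv ◅◅_))
                               (proj₂ (representative u)) (proj₂ (representative v))

    c : Fin n → Fin k
    c v = proj₁ (component-colouring (rep v)) v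

    c-proper : ∀ {u v} → P u → P v → Adj G u v → c u ≢ c v
    c-proper {u} {v} Pu Pv uv rewrite sym (rep-cong ((uv , Pu , Pv) ◅ ε)) =
      proj₂ (component-colouring (rep u)) rep→u (rep→u ◅◅ (uv , Pu , Pv) ◅ ε) uv
      where
      rep→u : ConnectedIn P (rep u) u
      rep→u = connectedIn-sym P (proj₁ (proj₂ (representative u)))

module RichSquareColouring
  (G : Graph) (u₁ u₂ u₃ u₄ : Fin (Graph.n G))
  (u₁≁u₃ : ¬ Adj G u₁ u₃) (u₂≁u₄ : ¬ Adj G u₂ u₄)
  (links : ∀ x → Square.NotInS G u₁ u₂ u₃ u₄ x → Square.ComponentIsLink G u₁ u₂ u₃ u₄ x)
  where
  open Graph G
  open Square G u₁ u₂ u₃ u₄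
  open ConsecutiveEnumeration

  InS : Pred (Fin n) 0ℓ
  InS v = (v ≡ u₁ ⊎ v ≡ u₃) ⊎ (v ≡ u₂ ⊎ v ≡ u₄)

  notInS? : Decidable NotInS
  notInS? v = ¬? (v ≟ u₁) ×-dec ¬? (v ≟ u₂) ×-dec ¬? (v ≟ u₃) ×-dec ¬? (v ≟ u₄)

  notInS-or-inS : Universal (NotInS ∪ InS)
  notInS-or-inS v with v ≟ u₁ | v ≟ u₂ | v ≟ u₃ | v ≟ u₄
  ... | yes e | _     | _     | _     = inj₂ (inj₁ (inj₁ e))
  ... | _     | yes e | _     | _     = inj₂ (inj₂ (inj₁ e))
  ... | _     | _     | yes e | _     = inj₂ (inj₁ (inj₂ e))
  ... | _     | _     | _     | yes e = inj₂ (inj₂ (inj₂ e))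
  ... | no ≢₁ | no ≢₂ | no ≢₃ | no ≢₄ = inj₁ (≢₁ , ≢₂ , ≢₃ , ≢₄)

  square-colouring : ProperColouringOn G InS 2
  square-colouring = colouring-∪ G (λ v → v ≟ u₁ ⊎-dec v ≟ u₃)
    (independent-colouring G (pair-independent G u₁≁u₃))
    (independent-colouring G (pair-independent G u₂≁u₄))

  link-enumeration : ∀ {x} → ComponentIsLink x → ConsecutiveEnumeration G (Connected x)
  link-enumeration (k , f , spans , _ , induced , _) = record
    { len = k ; vertex = f ; spans = spans
    ; adjacent⇒consecutive = λ i j → Equivalence.to (induced i j) }

  singleton-enumeration : ∀ {x} → ¬ NotInS x → ConsecutiveEnumeration G (Connected x)
  singleton-enumeration {x} x∈S = record
    { len = 0 ; vertex = λ _ → x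
    ; spans = λ y → mk⇔ (λ xy → fzero , connectedIn-outside G NotInS x∈S xy) λ { (_ , refl) → ε }
    ; adjacent⇒consecutive = λ _ _ xx → contradiction xx (Adj-irrefl G x) }

  component-enumeration : ∀ x → ConsecutiveEnumeration G (Connected x)
  component-enumeration x with notInS? x
  ... | yes x∉S = link-enumeration (links x x∉S)
  ... | no x∈S  = singleton-enumeration x∈S

  outside-colouring : ProperColouringOn G NotInS 2
  outside-colouring = colouring-by-components G
    (decidable ∘ component-enumeration) (colouring ∘ component-enumeration)

  proper-4-colouring : ProperColouring G 4
  proper-4-colouring =
    universal-colouring G notInS-or-inS (colouring-∪ G notInS? outside-colouring square-colouring)

lemma4p5 : (G : Graph) → RichSquare G → χ≤ G 4
lemma4p5 G (u₁ , u₂ , u₃ , u₄ , (_ , _ , u₁≁u₃ , u₂≁u₄) , _ , links) = proper-4-colouring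
  where open RichSquareColouring G u₁ u₂ u₃ u₄ u₁≁u₃ u₂≁u₄ links
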